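{- Let $V$ be a finite set of boxes and let $w,w':V\to[0,1]^d$ be size functions. Let $\mathcal E_{+}=(\mathcal E_{+,1},\dots,\mathcal E_{+,d})$ be a $d$-tuple of edge sets on $V$, and let $(G_1,\dots,G_d)$, $G_i=(V,E_i)$, be a packing class for $(V,w)$ with $\mathcal E_{+,i}\subseteq E_i$ for $i=1,\dots,d$. Suppose that for all $i\in\{1,\dots,d\}$, $$\mathcal F(V,w_i,\mathcal E_{+,i})\subseteq\mathcal F(V,w'_i).$$ Then $(G_1,\dots,G_d)$ is a packing class for $(V,w')$.
   Context: For a size function $w$ and coordinate $i$, $\mathcal F(V,w_i)=\{S\subseteq V:\sum_{b\in S}w_i(b)\le1\}$. For $S\subseteq V$, $K(S)$ denotes the edge set of the complete graph on $S$, and for an edge set $\mathcal E$ on $V$, $\mathcal F(V,w_i,\mathcal E)=\{S\in\mathcal F(V,w_i): K(S)\cap\mathcal E=\emptyset\}$. A packing class for $(V,w)$ is a $d$-tuple of graphs $G_i=(V,E_i)$ such that each $G_i$ is an interval graph, every stable set of $G_i$ lies in $\mathcal F(V,w_i)$, and $\bigcap_{i=1}^dE_i=\emptyset$. -}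

module Defs where

open import Level using (Level; _⊔_)
open import Data.Nat using (ℕ)
open import Data.Fin using (Fin; zero; suc)
open import Data.Fin.Subset using (Subset; _∈_; inside; outside)
open import Data.Vec using (Vec; []; _∷_)
open import Data.Product using (Σ; ∃; _×_; _,_)
open import Relation.Binary.PropositionalEquality using (_≡_; _≢_)
open import Relation.Nullary using (¬_)

-- The paper uses the reals; we allow any carrier with 0, 1, + and ≤
-- (no laws assumed), which contains the real case as an instance.
record NumDomain (c ℓ : Level) : Set (Level.suc (c ⊔ ℓ)) where
  field
    Carrier : Set c
    0#      : Carrier
    1#      : Carrier
    _+_     : Carrier → Carrier → Carrier
    _≤_     : Carrier → Carrier → Set ℓ

module _ {c ℓ : Level} (R : NumDomain c ℓ) where
  open NumDomain R

  -- Boxes are V = Fin n, dimensions are Fin d.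
  -- A size function w : V → [0,1]^d, given coordinatewise.
  record SizeFunction (n d : ℕ) : Set (c ⊔ ℓ) where
    field
      size  : Fin n → Fin d → Carrier
      size≥0 : ∀ b i → 0# ≤ size b i
      size≤1 : ∀ b i → size b i ≤ 1#
  open SizeFunction public

  sumOver : ∀ {n} → Subset n → (Fin n → Carrier) → Carrier
  sumOver []            f = 0#
  sumOver (inside  ∷ s) f = f zero + sumOver s (λ b → f (suc b))
  sumOver (outside ∷ s) f = sumOver s (λ b → f (suc b))

  InF : ∀ {n d} → SizeFunction n d → Fin d → Subset n → Set ℓ
  InF w i S = sumOver S (λ b → size w b i) ≤ 1#

  IntervalsMeet : Carrier × Carrier → Carrier × Carrier → Set (c ⊔ ℓ)
  IntervalsMeet (l₁ , r₁) (l₂ , r₂) =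
    ∃ λ x → (l₁ ≤ x × x ≤ r₁) × (l₂ ≤ x × x ≤ r₂)

  IsIntervalGraph : ∀ {n} {e} → (Fin n → Fin n → Set e) → Set (c ⊔ ℓ ⊔ e)
  IsIntervalGraph {n} E =
    Σ (Fin n → Carrier × Carrier) λ I →
      (∀ b → let (l , r) = I b in l ≤ r) ×
      (∀ a b → (E a b → (a ≢ b × IntervalsMeet (I a) (I b)))
             × ((a ≢ b × IntervalsMeet (I a) (I b)) → E a b))

EdgeSet : ℕ → (e : Level) → Set (Level.suc e)
EdgeSet n e = Fin n → Fin n → Set e

NoEdgeIn : ∀ {n e} → EdgeSet n e → Subset n → Set e
NoEdgeIn E S = ∀ a b → a ∈ S → b ∈ S → a ≢ b → ¬ E a b

IsStable : ∀ {n e} → EdgeSet n e → Subset n → Set e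
IsStable = NoEdgeIn

_⊆E_ : ∀ {n e e'} → EdgeSet n e → EdgeSet n e' → Set (e ⊔ e')
E ⊆E E' = ∀ a b → E a b → E' a b

module _ {c ℓ : Level} (R : NumDomain c ℓ) where
  open NumDomain R

  InFE : ∀ {n d e} → SizeFunction R n d → Fin d → EdgeSet n e → Subset n → Set (ℓ ⊔ e)
  InFE w i E S = InF R w i S × NoEdgeIn E S

  record IsPackingClass {n d e} (w : SizeFunction R n d) (E : Fin d → EdgeSet n e)
         : Set (c ⊔ ℓ ⊔ e) where
    field
      interval     : ∀ i → IsIntervalGraph R (E i)
      stableFeasible : ∀ i S → IsStable (E i) S → InF R w i S
      emptyMeet    : ∀ a b → ¬ (∀ i → E i a b)

{-# OPTIONS --safe #-}
module Submission where

open import Defs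
open import Level using (Level)
open import Data.Nat using (ℕ)
open import Data.Fin using (Fin)
open import Data.Fin.Subset using (Subset)
open import Data.Product using (_,_)
open import Function using (_∘_)

NoEdgeIn-antitone : ∀ {n e e'} {E : EdgeSet n e} {E' : EdgeSet n e'} {S : Subset n} →
                    E ⊆E E' → NoEdgeIn E' S → NoEdgeIn E S
NoEdgeIn-antitone E⊆E' noEdge a b a∈S b∈S a≢b = noEdge a b a∈S b∈S a≢b ∘ E⊆E' a b

module _ {c ℓ : Level} (R : NumDomain c ℓ) {n d : ℕ} where

  stable⇒InFE : ∀ {e e₊} {w : SizeFunction R n d}
                {E₊ : Fin d → EdgeSet n e₊} {E : Fin d → EdgeSet n e} →
                IsPackingClass R w E → (∀ i → E₊ i ⊆E E i) →
                ∀ i S → IsStable (E i) S → InFE R w i (E₊ i) S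
  stable⇒InFE pc E₊⊆E i S stable =
    IsPackingClass.stableFeasible pc i S stable , NoEdgeIn-antitone (E₊⊆E i) stable

theorem17 : ∀ {c ℓ e e₊ : Level} (R : NumDomain c ℓ) {n d : ℕ}
    (w w' : SizeFunction R n d)
    (E₊ : Fin d → EdgeSet n e₊) (E : Fin d → EdgeSet n e) →
    IsPackingClass R w E →
    (∀ i → E₊ i ⊆E E i) →
    (∀ i (S : Subset n) → InFE R w i (E₊ i) S → InF R w' i S) →
    IsPackingClass R w' E
theorem17 R w w' E₊ E pc E₊⊆E F⊆F' = record
  { interval       = IsPackingClass.interval pc
  ; stableFeasible = λ i S stable → F⊆F' i S (stable⇒InFE R pc E₊⊆E i S stable)
  ; emptyMeet      = IsPackingClass.emptyMeet pc
  }
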